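{- The Diophantine equation $5^{x}-2^{x}=L_{r}$ in nonnegative integers $r,x$ has only the solution $(r,x)=(2,1)$.
   Context: $(L_n)_{n\ge0}$ is the Lucas sequence: $L_0=2$, $L_1=1$, $L_n=L_{n-1}+L_{n-2}$ for $n\ge 2$. -}

module Defs where

open import Data.Nat using (ℕ; zero; suc; _+_)

lucas : ℕ → ℕ
lucas zero = 2
lucas (suc zero) = 1
lucas (suc (suc n)) = lucas (suc n) + lucas n

module Submission where

-- For x ≥ 2 the number D = 5^x − 2^x satisfies D ≡ 0 (mod 3) and
-- D ≡ 1 (mod 4), while no Lucas number does both:
--   * L_r mod 3 has period 8 and vanishes only at even r (r ≡ 2 mod 4);
--   * L_r mod 4 has period 6 and equals 1 only at odd r (r ≡ 1 mod 6).
-- So D is never a Lucas number; the cases x = 0 (D = 0, but every Lucas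
-- number is positive) and x = 1 (D = 3 = L_r only for r = 2, as L is at
-- least 4 from index 3 on) are handled by size.

open import Defs
open import Data.Nat using (ℕ; zero; suc; _+_; _*_; _^_; _∸_; _%_; _≤_; s≤s; z≤n; NonZero)
open import Data.Nat.Properties using (≤-trans; m≤m+n; m≤n+m; m+n∸m≡n; m∸n+n≡m; ^-monoˡ-≤; ^-zeroˡ)
open import Data.Nat.DivMod using (%-distribˡ-+; [m+kn]%n≡m%n; m*n%n≡0)
open import Data.Nat.Tactic.RingSolver using (solve-∀)
open import Data.Product using (_×_; _,_; ∃-syntax)
open import Data.Sum using (_⊎_; inj₁; inj₂)
open import Function.Bundles using (_⇔_; mk⇔)
open import Relation.Binary.PropositionalEquality using (_≡_; _≢_; refl; sym; trans; cong; cong₂; subst; module ≡-Reasoning)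
open import Data.Empty using (⊥-elim)

lucas-periodic : ∀ m .{{_ : NonZero m}} p →
                 lucas p % m ≡ lucas 0 % m → lucas (suc p) % m ≡ lucas 1 % m →
                 ∀ n → lucas (n + p) % m ≡ lucas n % m
lucas-periodic m p start₀ start₁ zero = start₀
lucas-periodic m p start₀ start₁ (suc zero) = start₁
lucas-periodic m p start₀ start₁ (suc (suc n)) = begin
    (lucas (suc n + p) + lucas (n + p)) % m
  ≡⟨ %-distribˡ-+ (lucas (suc n + p)) (lucas (n + p)) m ⟩
    (lucas (suc n + p) % m + lucas (n + p) % m) % m
  ≡⟨ cong (_% m) (cong₂ _+_ (lucas-periodic m p start₀ start₁ (suc n))
                            (lucas-periodic m p start₀ start₁ n)) ⟩
    (lucas (suc n) % m + lucas n % m) % m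
  ≡⟨ sym (%-distribˡ-+ (lucas (suc n)) (lucas n) m) ⟩
    (lucas (suc n) + lucas n) % m
  ∎
  where open ≡-Reasoning

-- Modulo 3 the period is 8 (2,1,0,1,1,2,0,2), and odd-indexed terms are nonzero.
lucas-odd-mod-3 : ∀ k → lucas (1 + 2 * k) % 3 ≢ 0
lucas-odd-mod-3 zero = λ ()
lucas-odd-mod-3 (suc zero) = λ ()
lucas-odd-mod-3 (suc (suc zero)) = λ ()
lucas-odd-mod-3 (suc (suc (suc zero))) = λ ()
lucas-odd-mod-3 (suc (suc (suc (suc k)))) eq =
  lucas-odd-mod-3 k (trans (sym shift) eq)
  where
  index : ∀ k → 1 + 2 * (4 + k) ≡ (1 + 2 * k) + 8
  index = solve-∀
  shift : lucas (1 + 2 * (4 + k)) % 3 ≡ lucas (1 + 2 * k) % 3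
  shift = trans (cong (λ n → lucas n % 3) (index k)) (lucas-periodic 3 8 refl refl (1 + 2 * k))

-- Modulo 4 the period is 6 (2,1,3,0,3,3), and even-indexed terms are never 1.
lucas-even-mod-4 : ∀ k → lucas (2 * k) % 4 ≢ 1
lucas-even-mod-4 zero = λ ()
lucas-even-mod-4 (suc zero) = λ ()
lucas-even-mod-4 (suc (suc zero)) = λ ()
lucas-even-mod-4 (suc (suc (suc k))) eq =
  lucas-even-mod-4 k (trans (sym shift) eq)
  where
  index : ∀ k → 2 * (3 + k) ≡ 2 * k + 6
  index = solve-∀
  shift : lucas (2 * (3 + k)) % 4 ≡ lucas (2 * k) % 4
  shift = trans (cong (λ n → lucas n % 4) (index k)) (lucas-periodic 4 6 refl refl (2 * k))

even-or-odd : ∀ n → ∃[ k ] (n ≡ 2 * k ⊎ n ≡ 1 + 2 * k)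
even-or-odd zero = 0 , inj₁ refl
even-or-odd (suc n) with even-or-odd n
... | k , inj₁ refl = k , inj₂ refl
... | k , inj₂ refl = suc k , inj₁ (double-suc k)
  where
  double-suc : ∀ k → 2 + 2 * k ≡ 2 * suc k
  double-suc = solve-∀

-- No Lucas number is both ≡ 0 (mod 3) and ≡ 1 (mod 4): the first forces an
-- even index, the second an odd one.
lucas-not-0-mod-3-and-1-mod-4 : ∀ r → lucas r % 3 ≡ 0 → lucas r % 4 ≢ 1
lucas-not-0-mod-3-and-1-mod-4 r div3 one-mod-4 with even-or-odd r
... | k , inj₁ refl = lucas-even-mod-4 k one-mod-4
... | k , inj₂ refl = lucas-odd-mod-3 k div3

lucas-positive : ∀ n → 1 ≤ lucas n
lucas-positive zero = s≤s z≤n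
lucas-positive (suc zero) = s≤s z≤n
lucas-positive (suc (suc n)) = ≤-trans (lucas-positive (suc n)) (m≤m+n (lucas (suc n)) (lucas n))

lucas-≥4 : ∀ n → 4 ≤ lucas (3 + n)
lucas-≥4 zero = s≤s (s≤s (s≤s (s≤s z≤n)))
lucas-≥4 (suc zero) = s≤s (s≤s (s≤s (s≤s z≤n)))
lucas-≥4 (suc (suc n)) = ≤-trans (lucas-≥4 n) (m≤n+m (lucas (3 + n)) (lucas (4 + n)))

lucas≢0 : ∀ r → lucas r ≢ 0
lucas≢0 r eq with subst (1 ≤_) eq (lucas-positive r)
... | ()

lucas≡3⇒r≡2 : ∀ r → lucas r ≡ 3 → r ≡ 2
lucas≡3⇒r≡2 (suc (suc zero)) eq = refl
lucas≡3⇒r≡2 (suc (suc (suc n))) eq with subst (4 ≤_) eq (lucas-≥4 n)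
... | s≤s (s≤s (s≤s ()))

pow-sum-expansion : ∀ b c n → ∃[ q ] ((b + c) ^ n ≡ b ^ n + q * c)
pow-sum-expansion b c zero = 0 , refl
pow-sum-expansion b c (suc n) with pow-sum-expansion b c n
... | q , eq = b ^ n + (b + c) * q , trans (cong ((b + c) *_) eq) (expand b c (b ^ n) q)
  where
  expand : ∀ b c bⁿ q → (b + c) * (bⁿ + q * c) ≡ b * bⁿ + (bⁿ + (b + c) * q) * c
  expand = solve-∀

-- 5^x − 2^x is divisible by 3 = 5 − 2.
diff-mod-3 : ∀ x → (5 ^ x ∸ 2 ^ x) % 3 ≡ 0
diff-mod-3 x with pow-sum-expansion 2 3 x
... | q , eq = begin
    (5 ^ x ∸ 2 ^ x) % 3        ≡⟨ cong (λ t → (t ∸ 2 ^ x) % 3) eq ⟩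
    (2 ^ x + q * 3 ∸ 2 ^ x) % 3 ≡⟨ cong (_% 3) (m+n∸m≡n (2 ^ x) (q * 3)) ⟩
    (q * 3) % 3                ≡⟨ m*n%n≡0 q 3 ⟩
    0                          ∎
  where open ≡-Reasoning

-- For x ≥ 2, 5^x − 2^x ≡ 1 (mod 4): 5^x ≡ 1 and 4 divides 2^x.
diff-mod-4 : ∀ y → (5 ^ (2 + y) ∸ 2 ^ (2 + y)) % 4 ≡ 1
diff-mod-4 y with pow-sum-expansion 1 4 (2 + y)
... | q , eq = begin
    D % 4                      ≡⟨ sym ([m+kn]%n≡m%n D (2 ^ y) 4) ⟩
    (D + 2 ^ y * 4) % 4        ≡⟨ cong (λ t → (D + t) % 4) (times-four (2 ^ y)) ⟩
    (D + 2 ^ (2 + y)) % 4      ≡⟨ cong (_% 4) (m∸n+n≡m (^-monoˡ-≤ (2 + y) 2≤5)) ⟩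
    5 ^ (2 + y) % 4            ≡⟨ cong (_% 4) eq ⟩
    (1 ^ (2 + y) + q * 4) % 4  ≡⟨ cong (λ t → (t + q * 4) % 4) (^-zeroˡ (2 + y)) ⟩
    (1 + q * 4) % 4            ≡⟨ [m+kn]%n≡m%n 1 q 4 ⟩
    1                          ∎
  where
  open ≡-Reasoning
  D : ℕ
  D = 5 ^ (2 + y) ∸ 2 ^ (2 + y)
  2≤5 : 2 ≤ 5
  2≤5 = s≤s (s≤s z≤n)
  times-four : ∀ t → t * 4 ≡ 2 * (2 * t)
  times-four = solve-∀

diff-not-lucas : ∀ y r → 5 ^ (2 + y) ∸ 2 ^ (2 + y) ≢ lucas r
diff-not-lucas y r eq =
  lucas-not-0-mod-3-and-1-mod-4 r
    (trans (cong (_% 3) (sym eq)) (diff-mod-3 (2 + y)))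
    (trans (cong (_% 4) (sym eq)) (diff-mod-4 y))

solutions : ∀ r x → 5 ^ x ∸ 2 ^ x ≡ lucas r → r ≡ 2 × x ≡ 1
solutions r zero eq = ⊥-elim (lucas≢0 r (sym eq))
solutions r (suc zero) eq = lucas≡3⇒r≡2 r (sym eq) , refl
solutions r (suc (suc y)) eq = ⊥-elim (diff-not-lucas y r eq)

corollary6 : (r x : ℕ) → ((5 ^ x ∸ 2 ^ x ≡ lucas r) ⇔ (r ≡ 2 × x ≡ 1))
corollary6 r x = mk⇔ (solutions r x) λ { (refl , refl) → refl }
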